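{- Let $G$ be a bridgeless cubic graph, let $F$ be a $2$-factor of $G$ such that $G/F$ is $5$-odd-edge-connected, and let $>_1$ be a strict total order on $\mathcal{C}^I_G(F)$. Then there exists a strict total order $>_2$ on $\mathcal{C}^U_G(F,>_1)$ such that for each $C\in\mathcal{C}^U_G(F,>_1)$ there exists a circuit $C^*$ of $F$ such that $\partial_G(C)$ and $\partial_G(C^*)$ have at least two edges in common and either $C^*\in\mathcal{C}^U_G(F,>_1)$ and $C>_2C^*$, or $C^*\notin\mathcal{C}^U_G(F,>_1)$.
   Context: A circuit is a connected $2$-regular subgraph; a $5$-circuit has $5$ edges. For a subgraph $H$, $\partial_G(H)$ is the set (multiset) of edges not in $E(H)$ incident with a vertex of $H$. A $2$-factor $F$ of $G$ is a spanning $2$-regular subgraph; its components are the circuits of $F$. $G/F$ is obtained by contracting all edges of $F$. A graph $H$ is $5$-odd-edge-connected if $|\partial_H(A)|\notin\{1,3\}$ for all $A\subseteq V(H)$, where $\partial_H(A)$ is the set of edges with exactly one end in $A$. Two circuits intersect if they share an edge. $\mathcal{C}^I_G$ is the set of $5$-circuits of $G$ intersecting some other $5$-circuit of $G$ in exactly one edge or exactly two adjacent edges; $\mathcal{C}^I_G(F)$ is the set of circuits of $F$ in $\mathcal{C}^I_G$. For $C\in\mathcal{C}^I_G(F)$ let $\mathcal{S}(C)$ be the set of circuits $C^*\neq C$ of $F$ such that some $5$-circuit of $G$ intersects both $C$ and $C^*$. Define $f_{>_1}(C)$: if $\mathcal{S}(C)\setminus\mathcal{C}^I_G(F)\neq\emptyset$,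 it is an (arbitrarily fixed) element of that set; otherwise it is the smallest element of $\mathcal{S}(C)$ with respect to $>_1$. Let $\mathcal{C}^P_G(F,>_1)$ be the set of $C\in\mathcal{C}^I_G(F)$ with $f_{>_1}(C)\in\mathcal{C}^I_G(F)$ and $f_{>_1}(f_{>_1}(C))=C$, and $\mathcal{C}^U_G(F,>_1)=\mathcal{C}^I_G(F)\setminus\mathcal{C}^P_G(F,>_1)$. -}

module Defs where

open import Data.Nat using (ℕ; zero; suc; _+_)
open import Data.Bool using (Bool; true; false; if_then_else_; _xor_)
open import Data.Fin using (Fin; zero; suc; _≟_)
open import Data.Fin.Subset using (Subset; _∈_; _∉_; _∩_; ∣_∣; _⊆_)
open import Data.Vec using (lookup)
open import Data.Product using (Σ; ∃; ∃-syntax; _×_; _,_)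
open import Data.Sum using (_⊎_)
open import Relation.Nullary using (¬_; does)
open import Relation.Binary.PropositionalEquality using (_≡_; _≢_)

sumFin : ∀ {m} → (Fin m → ℕ) → ℕ
sumFin {zero}  f = 0
sumFin {suc m} f = f zero + sumFin (λ i → f (suc i))

-- A finite multigraph (parallel edges and loops allowed):
-- vertices Fin nV, edges Fin nE, each edge has two end vertices.
record Graph : Set where
  field
    nV   : ℕ
    nE   : ℕ
    src  : Fin nE → Fin nV
    tgt  : Fin nE → Fin nV

open Graph public

StrictTotalOn : {A : Set} → (A → Set) → (A → A → Set) → Set
StrictTotalOn {A} P R =
  (∀ x → P x → ¬ R x x) ×
  (∀ x y z → P x → P y → P z → R x y → R y z → R x z) ×
  (∀ x y → P x → P y → x ≢ y → R x y ⊎ R y x)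

module _ (G : Graph) where

  V = Fin (nV G)
  E = Fin (nE G)
  -- subgraphs are given by their edge sets
  ESet = Subset (nE G)
  VSet = Subset (nV G)

  Inc : E → V → Set
  Inc e v = (src G e ≡ v) ⊎ (tgt G e ≡ v)

  -- number of edge-ends at v of edges in H (a loop counts twice)
  degIn : ESet → V → ℕ
  degIn H v = sumFin (λ e → if lookup H e
                              then ((if does (src G e ≟ v) then 1 else 0)
                                    + (if does (tgt G e ≟ v) then 1 else 0))
                              else 0)

  deg : V → ℕ
  deg v = sumFin (λ e → (if does (src G e ≟ v) then 1 else 0)
                        + (if does (tgt G e ≟ v) then 1 else 0))

  cutSize : VSet → ℕ
  cutSize A = sumFin (λ e → if lookup A (src G e) xor lookup A (tgt G e) then 1 else 0)

  Cubic : Set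
  Cubic = ∀ v → deg v ≡ 3

  -- no edge cut of size one (equivalently, no edge whose deletion
  -- increases the number of components)
  Bridgeless : Set
  Bridgeless = ∀ (A : VSet) → cutSize A ≢ 1

  VertOf : ESet → V → Set
  VertOf H v = ∃[ e ] (e ∈ H × Inc e v)

  data Reach (H : ESet) : V → V → Set where
    here  : ∀ {u} → Reach H u u
    stepF : ∀ {u w} e → e ∈ H → src G e ≡ u → Reach H (tgt G e) w → Reach H u w
    stepB : ∀ {u w} e → e ∈ H → tgt G e ≡ u → Reach H (src G e) w → Reach H u w

  IsCircuit : ESet → Set
  IsCircuit C =
    (∃[ e ] (e ∈ C)) ×
    (∀ v → VertOf C v → degIn C v ≡ 2) ×
    (∀ u v → VertOf C u → VertOf C v → Reach C u v)

  FiveCircuit : ESet → Set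
  FiveCircuit C = IsCircuit C × ∣ C ∣ ≡ 5

  TwoFactor : ESet → Set
  TwoFactor F = ∀ v → degIn F v ≡ 2

  CircuitOf : ESet → ESet → Set
  CircuitOf F C = IsCircuit C × C ⊆ F

  -- A ⊆ V(G) is a union of components of F, i.e. corresponds to a
  -- vertex subset of G/F; its cut in G/F equals its cut in G.
  FClosed : ESet → VSet → Set
  FClosed F A = ∀ e → e ∈ F → lookup A (src G e) ≡ lookup A (tgt G e)

  QuotientFiveOddEdgeConnected : ESet → Set
  QuotientFiveOddEdgeConnected F =
    ∀ (A : VSet) → FClosed F A → (cutSize A ≢ 1) × (cutSize A ≢ 3)

  Adjacent : E → E → Set
  Adjacent e f = ∃[ v ] (Inc e v × Inc f v)

  TwoAdjacentCommon : ESet → ESet → Set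
  TwoAdjacentCommon C D =
    ∣ C ∩ D ∣ ≡ 2 ×
    ∃[ e₁ ] ∃[ e₂ ] (e₁ ≢ e₂ × e₁ ∈ C ∩ D × e₂ ∈ C ∩ D × Adjacent e₁ e₂)

  Intersect : ESet → ESet → Set
  Intersect C D = ∃[ e ] (e ∈ C × e ∈ D)

  InCI : ESet → Set
  InCI C = FiveCircuit C ×
    ∃[ D ] (FiveCircuit D × D ≢ C × (∣ C ∩ D ∣ ≡ 1 ⊎ TwoAdjacentCommon C D))

  InCIF : ESet → ESet → Set
  InCIF F C = CircuitOf F C × InCI C

  InS : ESet → ESet → ESet → Set
  InS F C C* = CircuitOf F C* × C* ≢ C ×
    ∃[ D ] (FiveCircuit D × Intersect D C × Intersect D C*)

  -- f is a valid choice of f_{>₁} on 𝒞^I_G(F); R₁ x y means x >₁ y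
  IsFChoice : ESet → (ESet → ESet → Set) → (ESet → ESet) → Set
  IsFChoice F R₁ f = ∀ C → InCIF F C →
    ((∃[ X ] (InS F C X × ¬ InCIF F X)) → InS F C (f C) × ¬ InCIF F (f C)) ×
    (¬ (∃[ X ] (InS F C X × ¬ InCIF F X)) →
       InS F C (f C) × (∀ Y → InS F C Y → Y ≢ f C → R₁ Y (f C)))

  InCP : ESet → (ESet → ESet) → ESet → Set
  InCP F f C = InCIF F C × InCIF F (f C) × f (f C) ≡ C

  InCU : ESet → (ESet → ESet) → ESet → Set
  InCU F f C = InCIF F C × ¬ InCP F f C

  InBoundary : ESet → E → Set
  InBoundary H e = e ∉ H × ∃[ v ] (VertOf H v × Inc e v)

  ShareTwoBoundaryEdges : ESet → ESet → Set
  ShareTwoBoundaryEdges C C* = ∃[ e₁ ] ∃[ e₂ ] (e₁ ≢ e₂ ×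
    InBoundary C e₁ × InBoundary C* e₁ × InBoundary C e₂ × InBoundary C* e₂)

-- Take C* = f(C) ∈ 𝒮(C), and let D be a 5-circuit meeting both C and C*. In the cubic graph G every
-- vertex meets exactly one edge outside the 2-factor F, so the edges of D outside F form a matching of
-- a 5-circuit: there are at most two of them. Being connected, 2-regular and meeting both C and C*, D
-- crosses the vertex set of C a positive even number of times, and only through edges outside F (an
-- F-edge at a vertex of C belongs to C). Hence D has exactly two edges outside F, and both lie in ∂(C);
-- likewise in ∂(C*).
--
-- For >₂, rank C ∈ 𝒞^U by how many further iterates f(C), f²(C), … stay in 𝒞^U. If C and f(C) lie
-- in 𝒞^U and f²(C) ∈ 𝒞^I, then f²(C) ≠ C since C ∉ 𝒞^P, so minimality of f²(C) in 𝒮(f(C)) gives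
-- C >₁ f²(C). Thus a run inside 𝒞^U descends in >₁ at every second step; as distinct circuits of F
-- are edge-disjoint, runs are shorter than 2|E(G)| + 2 and ranks are finite. Ordering 𝒞^U by rank,
-- ties broken lexicographically, gives C >₂ f(C) whenever f(C) ∈ 𝒞^U.

module Submission where

open import Defs
open import Data.Bool using (Bool; true; false; if_then_else_; not; _∧_; _xor_)
import Data.Bool.Properties as Bool
open import Data.Bool.Properties using (∧-zeroʳ; xor-same)
open import Data.Empty using (⊥-elim)
open import Data.Fin using (Fin; zero; suc; _≟_; toℕ) renaming (_<_ to _<ᶠ_)
import Data.Fin.Properties as Fin
open import Data.Fin.Properties using (any?; all?; pigeonhole; toℕ<n)
open import Data.Fin.Subset using (Subset; _∈_; _∉_; _⊆_; _⊃_; _∪_; _∩_; ⁅_⁆; ∣_∣)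
open import Data.Fin.Subset.Induction using (Acc; acc; ⊃-wellFounded)
open import Data.Fin.Subset.Properties
  using (_∈?_; _⊆?_; ⊆-antisym; anySubset?; p⊆p∪q; x∈p∪q⁺; x∈p∪q⁻; x∈⁅x⁆; x∈⁅y⁆⇒x≡y)
open import Data.Nat using (ℕ; zero; suc; _+_; _*_; _≤_; _<_; z≤n; s≤s; s≤s⁻¹; >-nonZero)
import Data.Nat as ℕ
open import Data.Nat.Divisibility using (_∣_; _∣0; ∣m∣n⇒∣m+n; ∣m+n∣m⇒∣n; m∣m*n; n∣m*n; ∣⇒≤)
open import Data.Nat.GeneralisedArithmetic using (iterate)
open import Data.Nat.Properties
  using ( +-*-semiring; *-commutativeSemigroup; <-strictTotalOrder; module ≤-Reasoning
        ; ≤-refl; ≤-reflexive; ≤-trans; ≤-antisym; <-irrefl; <-trans; <⇒≤; ≤∧≢⇒<; m≤n⇒m<n∨m≡n; n<1+n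
        ; m≤m+n; m≤n+m; +-mono-≤; +-monoˡ-≤; +-mono-<-≤; +-mono-≤-<; +-identityʳ; +-suc; +-cancelˡ-≡
        ; *-comm; *-identityˡ; *-identityʳ; *-zeroʳ; *-distribˡ-+; *-distribʳ-+; *-monoˡ-≤
        ; *-cancelˡ-≤; *-cancelˡ-<; suc-injective )
open import Data.Product using (∃-syntax; _×_; _,_; proj₁; proj₂)
open import Data.Product.Relation.Binary.Lex.Strict using (×-strictTotalOrder)
open import Data.Sum using (_⊎_; inj₁; inj₂; map; map₁)
open import Data.Vec using ([]; _∷_; lookup)
open import Data.Vec.Properties using (≡-dec; lookup⇒[]=; []=⇒lookup)
open import Data.Vec.Relation.Binary.Lex.Strict as VecLex using ()
open import Data.Vec.Relation.Binary.Pointwise.Inductive using (Pointwise-≡⇒≡)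
open import Function using (_∘_)
open import Level using (0ℓ)
open import Relation.Binary.Bundles using (StrictTotalOrder)
open import Relation.Binary.Definitions using (tri<; tri≈; tri>)
open import Relation.Binary.PropositionalEquality
  using (_≡_; _≢_; refl; sym; trans; cong; cong₂; subst; module ≡-Reasoning)
open import Relation.Nullary using (¬_; does; Dec; yes; no)
open import Relation.Nullary.Decidable
  using (toSum; map′; _×-dec_; _⊎-dec_; _→-dec_; ¬?; decidable-stable; dec-true; dec-false)

open import Algebra.Properties.CommutativeSemigroup *-commutativeSemigroup using (x∙yz≈y∙xz)
open import Algebra.Properties.Semiring.Sum +-*-semiring
  using (sum; sum-syntax; sum-cong-≗; ∑-distrib-+; ∑-comm; *-distribˡ-sum)

-- Finite sums

𝟙 : Bool → ℕ
𝟙 true  = 1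
𝟙 false = 0

δ : ∀ {n} → Fin n → Fin n → ℕ
δ a v = if does (a ≟ v) then 1 else 0

sumFin≡sum : ∀ {n} (f : Fin n → ℕ) → sumFin f ≡ sum f
sumFin≡sum {zero}  f = refl
sumFin≡sum {suc n} f = cong (f zero +_) (sumFin≡sum (f ∘ suc))

sum-zero : ∀ {n} (f : Fin n → ℕ) → (∀ i → f i ≡ 0) → sum f ≡ 0
sum-zero {zero}  f f≡0 = refl
sum-zero {suc n} f f≡0 = cong₂ _+_ (f≡0 zero) (sum-zero (f ∘ suc) (f≡0 ∘ suc))

sum-mono-≤ : ∀ {n} {f g : Fin n → ℕ} → (∀ i → f i ≤ g i) → sum f ≤ sum g
sum-mono-≤ {zero}  f≤g = z≤n
sum-mono-≤ {suc n} f≤g = +-mono-≤ (f≤g zero) (sum-mono-≤ (f≤g ∘ suc))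

sum-mono-< : ∀ {n} {f g : Fin n → ℕ} → (∀ i → f i ≤ g i) → ∀ j → f j < g j → sum f < sum g
sum-mono-< f≤g zero    fj<gj = +-mono-<-≤ fj<gj (sum-mono-≤ (f≤g ∘ suc))
sum-mono-< f≤g (suc j) fj<gj = +-mono-≤-< (f≤g zero) (sum-mono-< (f≤g ∘ suc) j fj<gj)

sum-mono-≤-≡⇒≗ : ∀ {n} {f g : Fin n → ℕ} → (∀ i → f i ≤ g i) → sum f ≡ sum g → ∀ i → f i ≡ g i
sum-mono-≤-≡⇒≗ f≤g ∑f≡∑g i with m≤n⇒m<n∨m≡n (f≤g i)
... | inj₁ fi<gi = ⊥-elim (<-irrefl ∑f≡∑g (sum-mono-< f≤g i fi<gi))
... | inj₂ fi≡gi = fi≡gi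

term≤sum : ∀ {n} (f : Fin n → ℕ) i → f i ≤ sum f
term≤sum f zero    = m≤m+n (f zero) _
term≤sum f (suc i) = ≤-trans (term≤sum (f ∘ suc) i) (m≤n+m _ (f zero))

sum-*δ : ∀ {n} (w : Fin n → ℕ) a → ∑[ v < n ] (w v * δ a v) ≡ w a
sum-*δ {suc n} w zero = begin
  w zero * 1 + ∑[ v < n ] (w (suc v) * 0) ≡⟨ cong₂ _+_ (*-identityʳ (w zero)) (sum-zero _ (*-zeroʳ ∘ w ∘ suc)) ⟩
  w zero + 0                              ≡⟨ +-identityʳ (w zero) ⟩
  w zero                                  ∎
  where open ≡-Reasoning
sum-*δ {suc n} w (suc a) = begin
  w zero * 0 + ∑[ v < n ] (w (suc v) * δ a v) ≡⟨ cong₂ _+_ (*-zeroʳ (w zero)) (sum-*δ (w ∘ suc) a) ⟩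
  w (suc a)                                   ∎
  where open ≡-Reasoning

sum-∣ : ∀ {d n} (f : Fin n → ℕ) → (∀ i → d ∣ f i) → d ∣ sum f
sum-∣ {d} {zero}  f d∣f = d ∣0
sum-∣ {d} {suc n} f d∣f = ∣m∣n⇒∣m+n (d∣f zero) (sum-∣ (f ∘ suc) (d∣f ∘ suc))

one-positive : ∀ {n} (f : Fin n → ℕ) → 1 ≤ sum f → ∃[ i ] (1 ≤ f i)
one-positive {suc n} f 1≤∑ with f zero in eq
... | zero  = let i , 1≤fi = one-positive (f ∘ suc) 1≤∑
              in suc i , 1≤fi
... | suc _ = zero , subst (1 ≤_) (sym eq) (s≤s z≤n)

two-positive : ∀ {n} (f : Fin n → ℕ) → (∀ i → f i ≤ 1) → 2 ≤ sum f →
  ∃[ i ] ∃[ j ] (i ≢ j × 1 ≤ f i × 1 ≤ f j)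
two-positive {suc n} f f≤1 2≤∑ with f zero in eq
... | zero = let i , j , i≢j , 1≤fi , 1≤fj = two-positive (f ∘ suc) (f≤1 ∘ suc) 2≤∑
             in suc i , suc j , i≢j ∘ Fin.suc-injective , 1≤fi , 1≤fj
... | suc zero = let j , 1≤fj = one-positive (f ∘ suc) (s≤s⁻¹ 2≤∑)
                 in zero , suc j , (λ ()) , ≤-reflexive (sym eq) , 1≤fj
... | suc (suc _) with s≤s () ← subst (_≤ 1) eq (f≤1 zero)

∣p∣≡∑𝟙 : ∀ {n} (p : Subset n) → ∣ p ∣ ≡ ∑[ i < n ] 𝟙 (lookup p i)
∣p∣≡∑𝟙 []           = refl
∣p∣≡∑𝟙 (true ∷ p)  = cong suc (∣p∣≡∑𝟙 p)
∣p∣≡∑𝟙 (false ∷ p) = ∣p∣≡∑𝟙 p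

𝟙≤1 : ∀ b → 𝟙 b ≤ 1
𝟙≤1 true  = ≤-refl
𝟙≤1 false = z≤n

does≡true⇒ : ∀ {A : Set} (a? : Dec A) → does a? ≡ true → A
does≡true⇒ (yes a) _ = a

-- Runs of an iteration and orders given by a key

iterate-suc : ∀ {A : Set} (f : A → A) x n → iterate f x (suc n) ≡ f (iterate f x n)
iterate-suc f x zero    = refl
iterate-suc f x (suc n) = iterate-suc f (f x) n

module RunLength {A : Set} (f : A → A) {P : A → Set} (P? : ∀ x → Dec (P x)) where

  run : ℕ → A → ℕ
  run zero    c = 0
  run (suc k) c with P? (f c)
  ... | yes _ = suc (run k (f c))
  ... | no  _ = 0

  run≤ : ∀ k c → run k c ≤ k
  run≤ zero    c = z≤n
  run≤ (suc k) c with P? (f c)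
  ... | yes _ = s≤s (run≤ k (f c))
  ... | no  _ = z≤n

  run-stable : ∀ k c → run k c < k → run (suc k) c ≡ run k c
  run-stable (suc k) c run<k with P? (f c)
  ... | yes _ = cong suc (run-stable k (f c) (s≤s⁻¹ run<k))
  ... | no  _ = refl

  run-full : ∀ k c → run k c ≡ k → ∀ i → i < k → P (iterate f (f c) i)
  run-full (suc k) c run≡k i i<k with P? (f c)
  run-full (suc k) c run≡k zero    i<k | yes p = p
  run-full (suc k) c run≡k (suc i) i<k | yes _ = run-full k (f c) (suc-injective run≡k) i (s≤s⁻¹ i<k)

  run-suc : ∀ {k c} → P (f c) → run (suc k) c ≡ suc (run k (f c))
  run-suc {k} {c} pfc with P? (f c)
  ... | yes _   = refl
  ... | no ¬pfc = ⊥-elim (¬pfc pfc)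

  module _ (N : ℕ) (bounded : ∀ c → ¬ (∀ i → i < N → P (iterate f (f c) i))) where

    rank : A → ℕ
    rank = run N

    rank-step : ∀ {c} → P (f c) → rank c ≡ suc (rank (f c))
    rank-step {c} pfc = trans (sym (run-stable N c run<N)) (run-suc pfc)
      where
      run<N : run N c < N
      run<N = ≤∧≢⇒< (run≤ N c) (λ run≡N → bounded c (run-full N c run≡N))

module _ {A : Set} {P : A → Set} {R : A → A → Set}
         (R-trans : ∀ x y z → P x → P y → P z → R x y → R y z → R x z)
         (d : ℕ → A) {m : ℕ} (P-d : ∀ k → k ≤ m → P (d k))
         (step : ∀ k → k < m → R (d k) (d (suc k))) where

  descending-chain : ∀ {i j} → i < j → j ≤ m → R (d i) (d j)
  descending-chain {i} {suc j} i<1+j 1+j≤m with m≤n⇒m<n∨m≡n (s≤s⁻¹ i<1+j)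
  ... | inj₂ refl = step i 1+j≤m
  ... | inj₁ i<j  = R-trans _ _ _
    (P-d i (≤-trans (<⇒≤ i<1+j) 1+j≤m)) (P-d j (<⇒≤ 1+j≤m)) (P-d (suc j) 1+j≤m)
    (descending-chain i<j (<⇒≤ 1+j≤m)) (step j 1+j≤m)

module _ (O : StrictTotalOrder 0ℓ 0ℓ 0ℓ) where

  open StrictTotalOrder O using (Carrier; _≈_; irrefl; compare; module Eq)
    renaming (_<_ to _≺_; trans to ≺-trans)

  strictTotalOn-key : ∀ {A : Set} (key : A → Carrier) → (∀ {x y} → key x ≈ key y → x ≡ y) →
    (P : A → Set) → StrictTotalOn P (λ x y → key y ≺ key x)
  strictTotalOn-key key key-injective P =
      (λ x _ → irrefl Eq.refl)
    , (λ x y z _ _ _ y≺x z≺y → ≺-trans z≺y y≺x)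
    , total
    where
    total : ∀ x y → P x → P y → x ≢ y → key y ≺ key x ⊎ key x ≺ key y
    total x y _ _ x≢y with compare (key y) (key x)
    ... | tri< y≺x _ _ = inj₁ y≺x
    ... | tri≈ _ y≈x _ = ⊥-elim (x≢y (sym (key-injective y≈x)))
    ... | tri> _ _ x≺y = inj₂ x≺y

-- Degrees and double counting

module _ (G : Graph) where

  open ≡-Reasoning

  ends : E G → V G → ℕ
  ends e v = δ (src G e) v + δ (tgt G e) v

  load : (E G → ℕ) → V G → ℕ
  load w v = ∑[ e < nE G ] (w e * ends e v)

  if≡𝟙* : ∀ b n → (if b then n else 0) ≡ 𝟙 b * n
  if≡𝟙* true  n = sym (*-identityˡ n)
  if≡𝟙* false n = refl

  degIn≡load : ∀ H v → degIn G H v ≡ load (𝟙 ∘ lookup H) v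
  degIn≡load H v = trans (sumFin≡sum (λ e → if lookup H e then ends e v else 0))
                         (sum-cong-≗ (λ e → if≡𝟙* (lookup H e) (ends e v)))

  deg≡load : ∀ v → deg G v ≡ load (λ _ → 1) v
  deg≡load v = trans (sumFin≡sum (λ e → ends e v))
                     (sum-cong-≗ (λ e → sym (*-identityˡ (ends e v))))

  load-+ : ∀ w w' v → load (λ e → w e + w' e) v ≡ load w v + load w' v
  load-+ w w' v = begin
    ∑[ e < nE G ] ((w e + w' e) * ends e v)
      ≡⟨ sum-cong-≗ (λ e → *-distribʳ-+ (ends e v) (w e) (w' e)) ⟩
    ∑[ e < nE G ] (w e * ends e v + w' e * ends e v)
      ≡⟨ ∑-distrib-+ (λ e → w e * ends e v) (λ e → w' e * ends e v) ⟩
    load w v + load w' v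
      ∎

  load-mono-≤ : ∀ {w w'} → (∀ e → w e ≤ w' e) → ∀ v → load w v ≤ load w' v
  load-mono-≤ w≤w' v = sum-mono-≤ (λ e → *-monoˡ-≤ (ends e v) (w≤w' e))

  load-cong : ∀ {w w'} → (∀ e → w e ≡ w' e) → ∀ v → load w v ≡ load w' v
  load-cong w≗w' v = sum-cong-≗ (λ e → cong (_* ends e v) (w≗w' e))

  sum-*ends : ∀ (x : V G → ℕ) e → ∑[ v < nV G ] (x v * ends e v) ≡ x (src G e) + x (tgt G e)
  sum-*ends x e = begin
    ∑[ v < nV G ] (x v * ends e v)
      ≡⟨ sum-cong-≗ (λ v → *-distribˡ-+ (x v) _ _) ⟩
    ∑[ v < nV G ] (x v * δ (src G e) v + x v * δ (tgt G e) v)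
      ≡⟨ ∑-distrib-+ (λ v → x v * δ (src G e) v) (λ v → x v * δ (tgt G e) v) ⟩
    ∑[ v < nV G ] (x v * δ (src G e) v) + ∑[ v < nV G ] (x v * δ (tgt G e) v)
      ≡⟨ cong₂ _+_ (sum-*δ x (src G e)) (sum-*δ x (tgt G e)) ⟩
    x (src G e) + x (tgt G e)
      ∎

  double-counting : ∀ (x : V G → ℕ) w →
    ∑[ v < nV G ] (x v * load w v) ≡ ∑[ e < nE G ] (w e * (x (src G e) + x (tgt G e)))
  double-counting x w = begin
    ∑[ v < nV G ] (x v * load w v)
      ≡⟨ sum-cong-≗ (λ v → *-distribˡ-sum (x v) (λ e → w e * ends e v)) ⟩
    ∑[ v < nV G ] ∑[ e < nE G ] (x v * (w e * ends e v))
      ≡⟨ ∑-comm (λ v e → x v * (w e * ends e v)) ⟩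
    ∑[ e < nE G ] ∑[ v < nV G ] (x v * (w e * ends e v))
      ≡⟨ sum-cong-≗ (λ e → sum-cong-≗ (λ v → x∙yz≈y∙xz (x v) (w e) _)) ⟩
    ∑[ e < nE G ] ∑[ v < nV G ] (w e * (x v * ends e v))
      ≡⟨ sum-cong-≗ (λ e → *-distribˡ-sum (w e) (λ v → x v * ends e v)) ⟨
    ∑[ e < nE G ] (w e * ∑[ v < nV G ] (x v * ends e v))
      ≡⟨ sum-cong-≗ (λ e → cong (w e *_) (sum-*ends x e)) ⟩
    ∑[ e < nE G ] (w e * (x (src G e) + x (tgt G e)))
      ∎

  handshake : ∀ w → ∑[ v < nV G ] load w v ≡ 2 * ∑[ e < nE G ] w e
  handshake w = begin
    ∑[ v < nV G ] load w v          ≡⟨ sum-cong-≗ (λ v → sym (*-identityˡ (load w v))) ⟩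
    ∑[ v < nV G ] (1 * load w v)    ≡⟨ double-counting (λ _ → 1) w ⟩
    ∑[ e < nE G ] (w e * 2)         ≡⟨ sum-cong-≗ (λ e → *-comm (w e) 2) ⟩
    ∑[ e < nE G ] (2 * w e)         ≡⟨ *-distribˡ-sum 2 w ⟨
    2 * ∑[ e < nE G ] w e           ∎

-- Deciding the graph predicates

module _ (G : Graph) where

  _≟ₛ_ : (H K : ESet G) → Dec (H ≡ K)
  _≟ₛ_ = ≡-dec Bool._≟_

  inc? : ∀ e v → Dec (Inc G e v)
  inc? e v = (src G e ≟ v) ⊎-dec (tgt G e ≟ v)

  vertOf? : ∀ H v → Dec (VertOf G H v)
  vertOf? H v = any? (λ e → (e ∈? H) ×-dec inc? e v)

  reach-trans : ∀ {H u v w} → Reach G H u v → Reach G H v w → Reach G H u w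
  reach-trans here                 r' = r'
  reach-trans (stepF e e∈H s≡u r) r' = stepF e e∈H s≡u (reach-trans r r')
  reach-trans (stepB e e∈H t≡u r) r' = stepB e e∈H t≡u (reach-trans r r')

  module Exploration (H : ESet G) (u : V G) where

    Exit : VSet G → E G → Set
    Exit A e = e ∈ H × ((src G e ∈ A × tgt G e ∉ A) ⊎ (tgt G e ∈ A × src G e ∉ A))

    exit? : ∀ A e → Dec (Exit A e)
    exit? A e = (e ∈? H) ×-dec (((src G e ∈? A) ×-dec ¬? (tgt G e ∈? A))
                                ⊎-dec ((tgt G e ∈? A) ×-dec ¬? (src G e ∈? A)))

    closed-reach : ∀ {A a b} → (∀ e → ¬ Exit A e) → a ∈ A → Reach G H a b → b ∈ A
    closed-reach noExit a∈A here = a∈A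
    closed-reach {A} noExit a∈A (stepF e e∈H refl r) = closed-reach noExit
      (decidable-stable (tgt G e ∈? A) (λ t∉A → noExit e (e∈H , inj₁ (a∈A , t∉A)))) r
    closed-reach {A} noExit a∈A (stepB e e∈H refl r) = closed-reach noExit
      (decidable-stable (src G e ∈? A) (λ s∉A → noExit e (e∈H , inj₂ (a∈A , s∉A)))) r

    Reachable : VSet G → Set
    Reachable A = ∀ {w} → w ∈ A → Reach G H u w

    reachable-∪ : ∀ {A b} → Reachable A → Reach G H u b → Reachable (A ∪ ⁅ b ⁆)
    reachable-∪ {A} {b} reachA reach-b w∈ with x∈p∪q⁻ A ⁅ b ⁆ w∈
    ... | inj₁ w∈A  = reachA w∈A
    ... | inj₂ w∈b  = subst (Reach G H u) (sym (x∈⁅y⁆⇒x≡y b w∈b)) reach-b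

    b∉p⇒p∪⁅b⁆⊃p : ∀ {A : VSet G} {b} → b ∉ A → (A ∪ ⁅ b ⁆) ⊃ A
    b∉p⇒p∪⁅b⁆⊃p {A} {b} b∉A = p⊆p∪q ⁅ b ⁆ , b , x∈p∪q⁺ (inj₂ (x∈⁅x⁆ b)) , b∉A

    explore : ∀ v A → Acc _⊃_ A → u ∈ A → Reachable A → Dec (Reach G H u v)
    explore v A (acc rec) u∈A reachA with any? (exit? A)
    ... | yes (e , e∈H , inj₁ (s∈A , t∉A)) =
      explore v (A ∪ ⁅ tgt G e ⁆) (rec (b∉p⇒p∪⁅b⁆⊃p t∉A)) (p⊆p∪q ⁅ tgt G e ⁆ u∈A)
        (reachable-∪ reachA (reach-trans (reachA s∈A) (stepF e e∈H refl here)))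
    ... | yes (e , e∈H , inj₂ (t∈A , s∉A)) =
      explore v (A ∪ ⁅ src G e ⁆) (rec (b∉p⇒p∪⁅b⁆⊃p s∉A)) (p⊆p∪q ⁅ src G e ⁆ u∈A)
        (reachable-∪ reachA (reach-trans (reachA t∈A) (stepB e e∈H refl here)))
    ... | no noExit = map′ reachA (closed-reach (λ e exit → noExit (e , exit)) u∈A) (v ∈? A)

  reach? : ∀ H u v → Dec (Reach G H u v)
  reach? H u v = explore v ⁅ u ⁆ (⊃-wellFounded ⁅ u ⁆) (x∈⁅x⁆ u)
    (λ w∈u → subst (Reach G H u) (sym (x∈⁅y⁆⇒x≡y u w∈u)) here)
    where open Exploration H u

  isCircuit? : ∀ C → Dec (IsCircuit G C)
  isCircuit? C = any? (_∈? C)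
    ×-dec all? (λ v → vertOf? C v →-dec (degIn G C v ℕ.≟ 2))
    ×-dec all? (λ u → all? (λ v → vertOf? C u →-dec (vertOf? C v →-dec reach? C u v)))

  fiveCircuit? : ∀ C → Dec (FiveCircuit G C)
  fiveCircuit? C = isCircuit? C ×-dec (∣ C ∣ ℕ.≟ 5)

  circuitOf? : ∀ F C → Dec (CircuitOf G F C)
  circuitOf? F C = isCircuit? C ×-dec (C ⊆? F)

  adjacent? : ∀ e f → Dec (Adjacent G e f)
  adjacent? e f = any? (λ v → inc? e v ×-dec inc? f v)

  twoAdjacentCommon? : ∀ C D → Dec (TwoAdjacentCommon G C D)
  twoAdjacentCommon? C D = (∣ C ∩ D ∣ ℕ.≟ 2) ×-dec any? (λ e₁ → any? (λ e₂ →
    ¬? (e₁ ≟ e₂) ×-dec (e₁ ∈? (C ∩ D)) ×-dec (e₂ ∈? (C ∩ D)) ×-dec adjacent? e₁ e₂))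

  intersect? : ∀ C D → Dec (Intersect G C D)
  intersect? C D = any? (λ e → (e ∈? C) ×-dec (e ∈? D))

  inCI? : ∀ C → Dec (InCI G C)
  inCI? C = fiveCircuit? C ×-dec anySubset? (λ D → fiveCircuit? D ×-dec ¬? (D ≟ₛ C)
    ×-dec ((∣ C ∩ D ∣ ℕ.≟ 1) ⊎-dec twoAdjacentCommon? C D))

  inCIF? : ∀ F C → Dec (InCIF G F C)
  inCIF? F C = circuitOf? F C ×-dec inCI? C

  inCP? : ∀ F f C → Dec (InCP G F f C)
  inCP? F f C = inCIF? F C ×-dec inCIF? F (f C) ×-dec (f (f C) ≟ₛ C)

  inCU? : ∀ F f C → Dec (InCU G F f C)
  inCU? F f C = inCIF? F C ×-dec ¬? (inCP? F f C)

  inS? : ∀ F C X → Dec (InS G F C X)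
  inS? F C X = circuitOf? F X ×-dec ¬? (X ≟ₛ C)
    ×-dec anySubset? (λ D → fiveCircuit? D ×-dec intersect? D C ×-dec intersect? D X)

-- Circuits of a 2-factor

module _ (G : Graph) where

  open ≡-Reasoning

  1≤ends : ∀ {e v} → Inc G e v → 1 ≤ ends G e v
  1≤ends {e} {v} (inj₁ s≡v) with src G e ≟ v
  ... | yes _  = s≤s z≤n
  ... | no s≢v = ⊥-elim (s≢v s≡v)
  1≤ends {e} {v} (inj₂ t≡v) with tgt G e ≟ v
  ... | yes _  = m≤n+m 1 _
  ... | no t≢v = ⊥-elim (t≢v t≡v)

  ¬Inc⇒ends≡0 : ∀ {e v} → ¬ Inc G e v → ends G e v ≡ 0
  ¬Inc⇒ends≡0 {e} {v} ¬inc with src G e ≟ v | tgt G e ≟ v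
  ... | yes s≡v | _       = ⊥-elim (¬inc (inj₁ s≡v))
  ... | no _    | yes t≡v = ⊥-elim (¬inc (inj₂ t≡v))
  ... | no _    | no _    = refl

  𝟙-mono-⊆ : ∀ {H K : ESet G} → H ⊆ K → ∀ e → 𝟙 (lookup H e) ≤ 𝟙 (lookup K e)
  𝟙-mono-⊆ {H} {K} H⊆K e with lookup H e in eq
  ... | false = z≤n
  ... | true  = ≤-reflexive (cong 𝟙 (sym ([]=⇒lookup (H⊆K (lookup⇒[]= e H eq)))))

  degIn-≡⇒incident-⊆ : ∀ {H K : ESet G} {v e} → H ⊆ K → degIn G H v ≡ degIn G K v →
    e ∈ K → Inc G e v → e ∈ H
  degIn-≡⇒incident-⊆ {H} {K} {v} {e} H⊆K degH≡degK e∈K inc with lookup H e in eq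
  ... | true  = lookup⇒[]= e H eq
  ... | false = ⊥-elim (<-irrefl 0≡ends (1≤ends inc))
    where
    termH≡termK : 0 ≡ 𝟙 (lookup K e) * ends G e v
    termH≡termK = subst (λ b → 𝟙 b * ends G e v ≡ 𝟙 (lookup K e) * ends G e v) eq
      (sum-mono-≤-≡⇒≗ (λ e → *-monoˡ-≤ (ends G e v) (𝟙-mono-⊆ H⊆K e))
        (trans (sym (degIn≡load G H v)) (trans degH≡degK (degIn≡load G K v))) e)
    0≡ends : 0 ≡ ends G e v
    0≡ends = begin
      0                             ≡⟨ termH≡termK ⟩
      𝟙 (lookup K e) * ends G e v   ≡⟨ cong (λ b → 𝟙 b * ends G e v) ([]=⇒lookup e∈K) ⟩
      1 * ends G e v                ≡⟨ *-identityˡ (ends G e v) ⟩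
      ends G e v                    ∎

  circuit-degree : ∀ {C} → IsCircuit G C → ∀ v → degIn G C v ≡ 0 ⊎ degIn G C v ≡ 2
  circuit-degree {C} (_ , deg≡2 , _) v with vertOf? G C v
  ... | yes v∈C = inj₂ (deg≡2 v v∈C)
  ... | no  v∉C = inj₁ (trans (degIn≡load G C v) (sum-zero _ term≡0))
    where
    term≡0 : ∀ e → 𝟙 (lookup C e) * ends G e v ≡ 0
    term≡0 e with lookup C e in eq
    ... | false = refl
    ... | true  = trans (*-identityˡ _) (¬Inc⇒ends≡0 (λ inc → v∉C (e , lookup⇒[]= e C eq , inc)))

module CircuitsOfFactor (G : Graph) (F : ESet G) (tf : TwoFactor G F) where

  factor-edge∈circuit : ∀ {C v e} → CircuitOf G F C → VertOf G C v → e ∈ F → Inc G e v → e ∈ C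
  factor-edge∈circuit ((_ , deg≡2 , _) , C⊆F) v∈C =
    degIn-≡⇒incident-⊆ G C⊆F (trans (deg≡2 _ v∈C) (sym (tf _)))

  reach-preserves-VertOf : ∀ {C C' a b} → C ⊆ F → CircuitOf G F C' →
    Reach G C a b → VertOf G C' a → VertOf G C' b
  reach-preserves-VertOf C⊆F C' here a∈C' = a∈C'
  reach-preserves-VertOf C⊆F C' (stepF e e∈C refl r) a∈C' =
    reach-preserves-VertOf C⊆F C' r (e , factor-edge∈circuit C' a∈C' (C⊆F e∈C) (inj₁ refl) , inj₂ refl)
  reach-preserves-VertOf C⊆F C' (stepB e e∈C refl r) a∈C' =
    reach-preserves-VertOf C⊆F C' r (e , factor-edge∈circuit C' a∈C' (C⊆F e∈C) (inj₂ refl) , inj₁ refl)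

  circuitOf-⊆ : ∀ {C C' v} → CircuitOf G F C → CircuitOf G F C' → VertOf G C v → VertOf G C' v → C ⊆ C'
  circuitOf-⊆ ((_ , _ , connected) , C⊆F) C' v∈C v∈C' {e} e∈C =
    factor-edge∈circuit C'
      (reach-preserves-VertOf C⊆F C' (connected _ _ v∈C (e , e∈C , inj₁ refl)) v∈C')
      (C⊆F e∈C) (inj₁ refl)

  circuitOf-unique : ∀ {C C' v} → CircuitOf G F C → CircuitOf G F C' → VertOf G C v → VertOf G C' v → C ≡ C'
  circuitOf-unique C C' v∈C v∈C' = ⊆-antisym (circuitOf-⊆ C C' v∈C v∈C') (circuitOf-⊆ C' C v∈C' v∈C)

  circuitOf-unique-edge : ∀ {C C' e} → CircuitOf G F C → CircuitOf G F C' → e ∈ C → e ∈ C' → C ≡ C'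
  circuitOf-unique-edge C C' e∈C e∈C' = circuitOf-unique C C' (_ , e∈C , inj₁ refl) (_ , e∈C' , inj₁ refl)

  circuitOf-pigeonhole : (C : Fin (suc (nE G)) → ESet G) → (∀ k → CircuitOf G F (C k)) →
    ∃[ i ] ∃[ j ] (i <ᶠ j × C i ≡ C j)
  circuitOf-pigeonhole C circ =
    let i , j , i<j , same-edge = pigeonhole ≤-refl (proj₁ ∘ edge)
    in i , j , i<j , circuitOf-unique-edge (circ i) (circ j)
                       (proj₂ (edge i)) (subst (_∈ C j) (sym same-edge) (proj₂ (edge j)))
    where
    edge : ∀ k → ∃[ e ] e ∈ C k
    edge k = proj₁ (proj₁ (circ k))

-- Edges crossing a vertex set

module _ (G : Graph) where

  open ≡-Reasoning

  crossing : ESet G → (V G → Bool) → E G → ℕ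
  crossing H X e = 𝟙 (lookup H e ∧ (X (src G e) xor X (tgt G e)))

  𝟙*-ends-split : ∀ h a b → 𝟙 h * (𝟙 a + 𝟙 b) ≡ 2 * 𝟙 (h ∧ a ∧ b) + 𝟙 (h ∧ (a xor b))
  𝟙*-ends-split false a     b     = refl
  𝟙*-ends-split true  false false = refl
  𝟙*-ends-split true  false true  = refl
  𝟙*-ends-split true  true  false = refl
  𝟙*-ends-split true  true  true  = refl

  circuit-crossing-even : ∀ {H} → IsCircuit G H → ∀ X → 2 ∣ ∑[ e < nE G ] crossing H X e
  circuit-crossing-even {H} circuit X =
    ∣m+n∣m⇒∣n (subst (2 ∣_) degree-sum even-degrees) (m∣m*n (∑[ e < nE G ] inside e))
    where
    inside : E G → ℕ
    inside e = 𝟙 (lookup H e ∧ X (src G e) ∧ X (tgt G e))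

    even-degrees : 2 ∣ ∑[ v < nV G ] (𝟙 (X v) * degIn G H v)
    even-degrees = sum-∣ _ (λ v → even (circuit-degree G circuit v))
      where
      even : ∀ {v} → degIn G H v ≡ 0 ⊎ degIn G H v ≡ 2 → 2 ∣ 𝟙 (X v) * degIn G H v
      even {v} (inj₁ d≡0) rewrite d≡0 = subst (2 ∣_) (sym (*-zeroʳ (𝟙 (X v)))) (2 ∣0)
      even {v} (inj₂ d≡2) rewrite d≡2 = n∣m*n (𝟙 (X v))

    degree-sum : ∑[ v < nV G ] (𝟙 (X v) * degIn G H v)
               ≡ 2 * ∑[ e < nE G ] inside e + ∑[ e < nE G ] crossing H X e
    degree-sum = begin
      ∑[ v < nV G ] (𝟙 (X v) * degIn G H v)
        ≡⟨ sum-cong-≗ (λ v → cong (𝟙 (X v) *_) (degIn≡load G H v)) ⟩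
      ∑[ v < nV G ] (𝟙 (X v) * load G (𝟙 ∘ lookup H) v)
        ≡⟨ double-counting G (𝟙 ∘ X) (𝟙 ∘ lookup H) ⟩
      ∑[ e < nE G ] (𝟙 (lookup H e) * (𝟙 (X (src G e)) + 𝟙 (X (tgt G e))))
        ≡⟨ sum-cong-≗ (λ e → 𝟙*-ends-split (lookup H e) (X (src G e)) (X (tgt G e))) ⟩
      ∑[ e < nE G ] (2 * inside e + crossing H X e)
        ≡⟨ ∑-distrib-+ (λ e → 2 * inside e) (crossing H X) ⟩
      ∑[ e < nE G ] (2 * inside e) + ∑[ e < nE G ] crossing H X e
        ≡⟨ cong (_+ ∑[ e < nE G ] crossing H X e) (*-distribˡ-sum 2 inside) ⟨
      2 * ∑[ e < nE G ] inside e + ∑[ e < nE G ] crossing H X e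
        ∎

  crossing-positive : ∀ {H X e} → e ∈ H → X (src G e) xor X (tgt G e) ≡ true →
    1 ≤ ∑[ e < nE G ] crossing H X e
  crossing-positive {H} {X} {e} e∈H crosses =
    ≤-trans (≤-reflexive (sym (cong₂ (λ h c → 𝟙 (h ∧ c)) ([]=⇒lookup e∈H) crosses)))
            (term≤sum (crossing H X) e)

  reach-crossing : ∀ {H X u w} → Reach G H u w → X u ≡ true → X w ≡ false →
    1 ≤ ∑[ e < nE G ] crossing H X e
  reach-crossing here Xu Xw with () ← trans (sym Xu) Xw
  reach-crossing {H} {X} (stepF e e∈H refl r) Xs Xw with X (tgt G e) in Xt
  ... | true  = reach-crossing r Xt Xw
  ... | false = crossing-positive {H} {X} e∈H (cong₂ _xor_ Xs Xt)
  reach-crossing {H} {X} (stepB e e∈H refl r) Xt Xw with X (src G e) in Xs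
  ... | true  = reach-crossing r Xs Xw
  ... | false = crossing-positive {H} {X} e∈H (cong₂ _xor_ Xs Xt)

  crossing⇒end : ∀ {H : ESet G} {X : V G → Bool} {e} → 1 ≤ 𝟙 (lookup H e ∧ (X (src G e) xor X (tgt G e))) →
    X (src G e) ≡ true ⊎ X (tgt G e) ≡ true
  crossing⇒end {H} {X} {e} 1≤c with X (src G e) | X (tgt G e)
  ... | true  | _     = inj₁ refl
  ... | false | true  = inj₂ refl
  ... | false | false with () ← subst (1 ≤_) (cong 𝟙 (∧-zeroʳ (lookup H e))) 1≤c

-- A 5-circuit through two circuits of a 2-factor

module FactorCrossing (G : Graph) (cubic : Cubic G) (F : ESet G) (tf : TwoFactor G F) where

  open CircuitsOfFactor G F tf
  open ≤-Reasoning

  factorPart nonFactor : ESet G → E G → ℕ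
  factorPart D e = 𝟙 (lookup D e ∧ lookup F e)
  nonFactor  D e = 𝟙 (lookup D e ∧ not (lookup F e))

  𝟙-split : ∀ d f → 𝟙 d ≡ 𝟙 (d ∧ f) + 𝟙 (d ∧ not f)
  𝟙-split false f     = refl
  𝟙-split true  false = refl
  𝟙-split true  true  = refl

  load-split : ∀ D v → load G (𝟙 ∘ lookup D) v ≡ load G (factorPart D) v + load G (nonFactor D) v
  load-split D v = trans (load-cong G (λ e → 𝟙-split (lookup D e) (lookup F e)) v)
                         (load-+ G (factorPart D) (nonFactor D) v)

  ∁-load≡1 : ∀ v → load G (𝟙 ∘ not ∘ lookup F) v ≡ 1
  ∁-load≡1 v = +-cancelˡ-≡ 2 _ _ (begin-equality
    2 + load G ∁F v                                         ≡⟨ cong (_+ load G ∁F v) F-load≡2 ⟨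
    load G (𝟙 ∘ lookup F) v + load G ∁F v                   ≡⟨ load-+ G (𝟙 ∘ lookup F) ∁F v ⟨
    load G (λ e → 𝟙 (lookup F e) + 𝟙 (not (lookup F e))) v ≡⟨ load-cong G (λ e → 𝟙+𝟙-not (lookup F e)) v ⟩
    load G (λ _ → 1) v                                      ≡⟨ deg≡load G v ⟨
    deg G v                                                 ≡⟨ cubic v ⟩
    3                                                       ∎)
    where
    ∁F : E G → ℕ
    ∁F = 𝟙 ∘ not ∘ lookup F
    F-load≡2 : load G (𝟙 ∘ lookup F) v ≡ 2
    F-load≡2 = trans (sym (degIn≡load G F v)) (tf v)
    𝟙+𝟙-not : ∀ b → 𝟙 b + 𝟙 (not b) ≡ 1
    𝟙+𝟙-not true  = refl
    𝟙+𝟙-not false = refl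

  nonFactor-load≤1 : ∀ D v → load G (nonFactor D) v ≤ 1
  nonFactor-load≤1 D v = ≤-trans (load-mono-≤ G (λ e → 𝟙-∧-≤ (lookup D e) _) v) (≤-reflexive (∁-load≡1 v))
    where
    𝟙-∧-≤ : ∀ d b → 𝟙 (d ∧ b) ≤ 𝟙 b
    𝟙-∧-≤ true  b = ≤-refl
    𝟙-∧-≤ false b = z≤n

  nonFactor-load≤factorPart-load : ∀ {D} → IsCircuit G D → ∀ v → load G (nonFactor D) v ≤ load G (factorPart D) v
  nonFactor-load≤factorPart-load {D} circuit v =
    smaller-summand (nonFactor-load≤1 D v) (map (trans split) (trans split) (circuit-degree G circuit v))
    where
    split : load G (factorPart D) v + load G (nonFactor D) v ≡ degIn G D v
    split = sym (trans (degIn≡load G D v) (load-split D v))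
    smaller-summand : ∀ {a b} → b ≤ 1 → a + b ≡ 0 ⊎ a + b ≡ 2 → b ≤ a
    smaller-summand {a}         {zero}        _ _ = z≤n
    smaller-summand {suc a}     {suc zero}    _ _ = s≤s z≤n
    smaller-summand {zero}      {suc zero}    _ (inj₁ ())
    smaller-summand {zero}      {suc zero}    _ (inj₂ ())
    smaller-summand {_}         {suc (suc _)} (s≤s ()) _

  circuit-nonFactor-half : ∀ {D} → IsCircuit G D → 2 * ∑[ e < nE G ] nonFactor D e ≤ ∣ D ∣
  circuit-nonFactor-half {D} circuit = begin
    2 * n            ≡⟨ cong (n +_) (+-identityʳ n) ⟩
    n + n            ≤⟨ +-monoˡ-≤ n n≤m ⟩
    m + n            ≡⟨ ∑-distrib-+ (factorPart D) (nonFactor D) ⟨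
    ∑[ e < nE G ] (factorPart D e + nonFactor D e) ≡⟨ sum-cong-≗ (λ e → 𝟙-split (lookup D e) (lookup F e)) ⟨
    ∑[ e < nE G ] 𝟙 (lookup D e) ≡⟨ ∣p∣≡∑𝟙 D ⟨
    ∣ D ∣            ∎
    where
    n m : ℕ
    n = ∑[ e < nE G ] nonFactor D e
    m = ∑[ e < nE G ] factorPart D e
    n≤m : n ≤ m
    n≤m = *-cancelˡ-≤ 2 (begin
      2 * n                              ≡⟨ handshake G (nonFactor D) ⟨
      ∑[ v < nV G ] load G (nonFactor D) v  ≤⟨ sum-mono-≤ (nonFactor-load≤factorPart-load circuit) ⟩
      ∑[ v < nV G ] load G (factorPart D) v ≡⟨ handshake G (factorPart D) ⟩
      2 * m                              ∎)

  fiveCircuit-nonFactor≤2 : ∀ {D} → FiveCircuit G D → ∑[ e < nE G ] nonFactor D e ≤ 2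
  fiveCircuit-nonFactor≤2 {D} (circuit , ∣D∣≡5) =
    s≤s⁻¹ (*-cancelˡ-< 2 _ 3 (s≤s (subst (2 * ∑[ e < nE G ] nonFactor D e ≤_) ∣D∣≡5
                                          (circuit-nonFactor-half circuit))))

  inV : ESet G → V G → Bool
  inV C v = does (vertOf? G C v)

  factor-edge-inV : ∀ {C e} → CircuitOf G F C → e ∈ F → inV C (src G e) ≡ inV C (tgt G e)
  factor-edge-inV {C} {e} circ e∈F with vertOf? G C (src G e) | vertOf? G C (tgt G e)
  ... | yes _   | yes _   = refl
  ... | no _    | no _    = refl
  ... | yes s∈C | no t∉C  = ⊥-elim (t∉C (e , factor-edge∈circuit circ s∈C e∈F (inj₁ refl) , inj₂ refl))
  ... | no s∉C  | yes t∈C = ⊥-elim (s∉C (e , factor-edge∈circuit circ t∈C e∈F (inj₂ refl) , inj₁ refl))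

  crossing≤nonFactor : ∀ {C} → CircuitOf G F C → ∀ D e → crossing G D (inV C) e ≤ nonFactor D e
  crossing≤nonFactor {C} circ D e = 𝟙-∧-≤ (lookup D e) (lookup F e)
    (λ e∈F → trans (cong (_xor inV C (tgt G e)) (factor-edge-inV circ (lookup⇒[]= e F e∈F)))
                   (xor-same (inV C (tgt G e))))
    where
    𝟙-∧-≤ : ∀ d f {c} → (f ≡ true → c ≡ false) → 𝟙 (d ∧ c) ≤ 𝟙 (d ∧ not f)
    𝟙-∧-≤ false f     _      = z≤n
    𝟙-∧-≤ true  false {c} _  = 𝟙≤1 c
    𝟙-∧-≤ true  true  c≡false = ≤-reflexive (cong 𝟙 (c≡false refl))

  crossing≥2 : ∀ {D C C*} → IsCircuit G D → CircuitOf G F C → CircuitOf G F C* → C ≢ C* →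
    Intersect G D C → Intersect G D C* → 2 ≤ ∑[ e < nE G ] crossing G D (inV C) e
  crossing≥2 {D} {C} circuitD circ circ* C≢C* (e₀ , e₀∈D , e₀∈C) (e₁ , e₁∈D , e₁∈C*) =
    ∣⇒≤ ⦃ >-nonZero 1≤∑ ⦄ (circuit-crossing-even G circuitD (inV C))
    where
    1≤∑ : 1 ≤ ∑[ e < nE G ] crossing G D (inV C) e
    1≤∑ = reach-crossing G {D} {inV C}
      (proj₂ (proj₂ circuitD) _ _ (e₀ , e₀∈D , inj₁ refl) (e₁ , e₁∈D , inj₁ refl))
      (dec-true (vertOf? G C _) (e₀ , e₀∈C , inj₁ refl))
      (dec-false (vertOf? G C _) (λ s∈C → C≢C* (circuitOf-unique circ circ* s∈C (e₁ , e₁∈C* , inj₁ refl))))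

  crossing≡nonFactor : ∀ {D C C*} → FiveCircuit G D → CircuitOf G F C → CircuitOf G F C* → C ≢ C* →
    Intersect G D C → Intersect G D C* → ∀ e → crossing G D (inV C) e ≡ nonFactor D e
  crossing≡nonFactor {D} five@(circuitD , _) circ circ* C≢C* D∩C D∩C* =
    sum-mono-≤-≡⇒≗ (crossing≤nonFactor circ D)
      (≤-antisym (sum-mono-≤ (crossing≤nonFactor circ D))
                 (≤-trans (fiveCircuit-nonFactor≤2 five) (crossing≥2 circuitD circ circ* C≢C* D∩C D∩C*)))

  nonFactor⇒∉F : ∀ {D e} → 1 ≤ nonFactor D e → e ∉ F
  nonFactor⇒∉F {D} {e} 1≤n e∈F with () ← subst (1 ≤_)
    (trans (cong (λ f → 𝟙 (lookup D e ∧ not f)) ([]=⇒lookup e∈F)) (cong 𝟙 (∧-zeroʳ (lookup D e)))) 1≤n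

  nonFactor⇒boundary : ∀ {D C e} → CircuitOf G F C → crossing G D (inV C) e ≡ nonFactor D e →
    1 ≤ nonFactor D e → InBoundary G C e
  nonFactor⇒boundary {D} {C} {e} circ c≡n 1≤n =
      (λ e∈C → nonFactor⇒∉F {D} 1≤n (proj₂ circ e∈C))
    , end∈C (crossing⇒end G {D} {inV C} {e} (subst (1 ≤_) (sym c≡n) 1≤n))
    where
    end∈C : inV C (src G e) ≡ true ⊎ inV C (tgt G e) ≡ true → ∃[ v ] (VertOf G C v × Inc G e v)
    end∈C (inj₁ s∈C) = src G e , does≡true⇒ (vertOf? G C _) s∈C , inj₁ refl
    end∈C (inj₂ t∈C) = tgt G e , does≡true⇒ (vertOf? G C _) t∈C , inj₂ refl

  share-boundary : ∀ {C C*} → CircuitOf G F C → InS G F C C* → ShareTwoBoundaryEdges G C C*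
  share-boundary {C} {C*} circ (circ* , C*≢C , D , five , D∩C , D∩C*) =
    let e₁ , e₂ , e₁≢e₂ , 1≤n₁ , 1≤n₂ = two-positive (nonFactor D) (λ e → 𝟙≤1 _) 2≤∑
    in e₁ , e₂ , e₁≢e₂ , ∂C 1≤n₁ , ∂C* 1≤n₁ , ∂C 1≤n₂ , ∂C* 1≤n₂
    where
    cross-C : ∀ e → crossing G D (inV C) e ≡ nonFactor D e
    cross-C = crossing≡nonFactor five circ circ* (C*≢C ∘ sym) D∩C D∩C*
    ∂C : ∀ {e} → 1 ≤ nonFactor D e → InBoundary G C e
    ∂C {e} = nonFactor⇒boundary {D} circ (cross-C e)
    ∂C* : ∀ {e} → 1 ≤ nonFactor D e → InBoundary G C* e
    ∂C* {e} = nonFactor⇒boundary {D} circ* (crossing≡nonFactor five circ* circ C*≢C D∩C* D∩C e)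
    2≤∑ : 2 ≤ ∑[ e < nE G ] nonFactor D e
    2≤∑ = ≤-trans (crossing≥2 (proj₁ five) circ circ* (C*≢C ∘ sym) D∩C D∩C*) (≤-reflexive (sum-cong-≗ cross-C))

-- The order >₂

module DescentOrder (G : Graph) (F : ESet G) (tf : TwoFactor G F)
  (R₁ : ESet G → ESet G → Set) (sto : StrictTotalOn (InCIF G F) R₁)
  (f : ESet G → ESet G) (fch : IsFChoice G F R₁ f) where

  open CircuitsOfFactor G F tf

  CU : ESet G → Set
  CU = InCU G F f

  f∈S : ∀ {C} → InCIF G F C → InS G F C (f C)
  f∈S {C} cifC with anySubset? (λ X → inS? G F C X ×-dec ¬? (inCIF? G F X))
  ... | yes outside  = proj₁ (proj₁ (fch C cifC) outside)
  ... | no ¬outside = proj₁ (proj₂ (fch C cifC) ¬outside)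

  f-minimal : ∀ {C} → InCIF G F C → InCIF G F (f C) → ∀ Y → InS G F C Y → Y ≢ f C → R₁ Y (f C)
  f-minimal {C} cifC ciffC =
    proj₂ (proj₂ (fch C cifC) (λ outside → proj₂ (proj₁ (fch C cifC) outside) ciffC))

  inS-sym : ∀ {C X} → CircuitOf G F C → InS G F C X → InS G F X C
  inS-sym circC (_ , X≢C , D , five , D∩C , D∩X) = circC , X≢C ∘ sym , D , five , D∩X , D∩C

  f²-descends : ∀ {C} → CU C → InCIF G F (f C) → InCIF G F (f (f C)) → R₁ C (f (f C))
  f²-descends (cifC , ¬cpC) ciffC cifffC =
    f-minimal ciffC cifffC _ (inS-sym (proj₁ cifC) (f∈S cifC)) (λ C≡ffC → ¬cpC (cifC , ciffC , sym C≡ffC))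

  N : ℕ
  N = suc (nE G) + suc (nE G)

  no-long-run : ∀ c → ¬ (∀ i → i < N → CU (iterate f (f c) i))
  no-long-run c run-in-CU =
    let i , j , i<j , dᵢ≡dⱼ = circuitOf-pigeonhole (d ∘ toℕ) (λ k → proj₁ (proj₁ (d-in-CU _ (bound k))))
    in proj₁ sto (d (toℕ i)) (proj₁ (d-in-CU _ (bound i)))
         (subst (R₁ (d (toℕ i))) (sym dᵢ≡dⱼ)
           (descending-chain (proj₁ (proj₂ sto)) d (λ k k≤nE → proj₁ (d-in-CU k k≤nE)) step i<j (bound j)))
    where
    s d : ℕ → ESet G
    s = iterate f (f c)
    d k = s (k + k)

    bound : (k : Fin (suc (nE G))) → toℕ k ≤ nE G
    bound k = s≤s⁻¹ (toℕ<n k)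

    index<N : ∀ {k} → k ≤ nE G → suc (k + k) < N
    index<N k≤nE = s≤s (≤-trans (s≤s (+-mono-≤ k≤nE k≤nE)) (≤-reflexive (sym (+-suc (nE G) (nE G)))))

    d-in-CU : ∀ k → k ≤ nE G → CU (d k)
    d-in-CU k k≤nE = run-in-CU (k + k) (<-trans (n<1+n _) (index<N k≤nE))

    fd-in-CU : ∀ k → k ≤ nE G → CU (f (d k))
    fd-in-CU k k≤nE = subst CU (iterate-suc f (f c) (k + k)) (run-in-CU (suc (k + k)) (index<N k≤nE))

    d-suc : ∀ k → d (suc k) ≡ f (f (d k))
    d-suc k = begin
      s (suc k + suc k)      ≡⟨ cong (s ∘ suc) (+-suc k k) ⟩
      s (suc (suc (k + k)))  ≡⟨ iterate-suc f (f c) (suc (k + k)) ⟩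
      f (s (suc (k + k)))    ≡⟨ cong f (iterate-suc f (f c) (k + k)) ⟩
      f (f (d k))            ∎
      where open ≡-Reasoning

    step : ∀ k → k < nE G → R₁ (d k) (d (suc k))
    step k k<nE = subst (R₁ (d k)) (sym (d-suc k))
      (f²-descends (d-in-CU k (<⇒≤ k<nE)) (proj₁ (fd-in-CU k (<⇒≤ k<nE)))
        (subst (InCIF G F) (d-suc k) (proj₁ (d-in-CU (suc k) k<nE))))

  open RunLength f (inCU? G F f) using (rank; rank-step)

  keyOrder : StrictTotalOrder 0ℓ 0ℓ 0ℓ
  keyOrder = ×-strictTotalOrder <-strictTotalOrder (VecLex.<-strictTotalOrder Bool.<-strictTotalOrder (nE G))

  key : ESet G → ℕ × ESet G
  key C = rank N no-long-run C , C

  R₂ : ESet G → ESet G → Set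
  R₂ C C' = StrictTotalOrder._<_ keyOrder (key C') (key C)

  R₂-strictTotal : StrictTotalOn CU R₂
  R₂-strictTotal = strictTotalOn-key keyOrder key (λ (_ , C≋C') → Pointwise-≡⇒≡ C≋C') CU

  R₂-f : ∀ {C} → CU (f C) → R₂ C (f C)
  R₂-f cufC = inj₁ (≤-reflexive (sym (rank-step N no-long-run cufC)))

  f-descends-or-leaves : ∀ C → (CU (f C) × R₂ C (f C)) ⊎ ¬ CU (f C)
  f-descends-or-leaves C = map₁ (λ cufC → cufC , R₂-f cufC) (toSum (inCU? G F f (f C)))

lemma12 : (G : Graph) → Cubic G → Bridgeless G →
    (F : ESet G) → TwoFactor G F → QuotientFiveOddEdgeConnected G F →
    (R₁ : ESet G → ESet G → Set) → StrictTotalOn (InCIF G F) R₁ →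
    (f : ESet G → ESet G) → IsFChoice G F R₁ f →
    ∃[ R₂ ] (StrictTotalOn (InCU G F f) R₂ ×
      (∀ C → InCU G F f C → ∃[ C* ] (CircuitOf G F C* ×
        ShareTwoBoundaryEdges G C C* ×
        ((InCU G F f C* × R₂ C C*) ⊎ ¬ InCU G F f C*))))
lemma12 G cubic _ F tf _ R₁ sto f fch = R₂ , R₂-strictTotal , witness
  where
  open DescentOrder G F tf R₁ sto f fch
  open FactorCrossing G cubic F tf using (share-boundary)

  witness : ∀ C → CU C → ∃[ C* ] (CircuitOf G F C* × ShareTwoBoundaryEdges G C C* × ((CU C* × R₂ C C*) ⊎ ¬ CU C*))
  witness C (cifC , _) = f C , proj₁ (f∈S cifC) , share-boundary (proj₁ cifC) (f∈S cifC) , f-descends-or-leaves C
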